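{- For $(n,d)=(120,5)$ and for $(n,d)=(924,29)$ there is no symmetric $n\times n$ circulant matrix $C$ with generator $(c_0,\ldots,c_{n-1})$ such that $c_0=d$, $c_j\in\{1,-1\}$ for $j=1,\ldots,n-1$, and $CC^T=(d^2+n-1)I$.
   Context: A circulant matrix of order $n$ with generator $(c_0,c_1,\ldots,c_{n-1})$ is the $n\times n$ matrix whose entry in row $i$ and column $j$ (indices $0,\ldots,n-1$) is $c_{(j-i)\bmod n}$. -}

module Defs where

open import Data.Nat as ℕ using (ℕ; zero; suc; _∸_)
open import Data.Nat.DivMod using (_%_; m%n<n)
open import Data.Fin using (Fin; toℕ; fromℕ<) renaming (zero to fzero; suc to fsuc)
open import Data.Integer using (ℤ; +_; -[1+_]; _*_; _+_)
open import Data.Product using (_×_)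
open import Data.Sum using (_⊎_)
open import Data.Fin.Properties using (_≟_)
open import Relation.Nullary using (yes; no)
open import Relation.Binary.PropositionalEquality using (_≡_; _≢_)

Matrix : ℕ → Set
Matrix n = Fin n → Fin n → ℤ

sumFin : ∀ {n} → (Fin n → ℤ) → ℤ
sumFin {zero} f = + 0
sumFin {suc n} f = f fzero + sumFin (λ i → f (fsuc i))

-- (j - i) mod n for j, i ∈ {0,…,n-1}, computed as (j + (n - i)) mod n.
subMod : ∀ {n} → Fin n → Fin n → Fin n
subMod {suc n} j i = fromℕ< (m%n<n (toℕ j ℕ.+ (suc n ∸ toℕ i)) (suc n))

circulant : ∀ {n} → (Fin n → ℤ) → Matrix n
circulant c i j = c (subMod j i)

transpose : ∀ {n} → Matrix n → Matrix n
transpose M i j = M j i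

_·_ : ∀ {n} → Matrix n → Matrix n → Matrix n
(A · B) i k = sumFin (λ j → A i j * B j k)

scalar : ∀ {n} → ℤ → Matrix n
scalar a i j with i ≟ j
... | yes _ = a
... | no _ = + 0

Symmetric : ∀ {n} → Matrix n → Set
Symmetric M = ∀ i j → M i j ≡ M j i

GoodCirculant : (m d : ℕ) → (Fin (suc m) → ℤ) → Set
GoodCirculant m d c =
    c fzero ≡ + d
  × (∀ (j : Fin m) → (c (fsuc j) ≡ + 1) ⊎ (c (fsuc j) ≡ -[1+ 0 ]))
  × Symmetric (circulant c)
  × (∀ i j → (circulant c · transpose (circulant c)) i j ≡ scalar (+ (d ℕ.* d ℕ.+ m)) i j)

-- Write cⱼ = 1 + 2uⱼ, with uⱼ ∈ {0, −1} (so uⱼ² = −uⱼ) for j ≠ 0, and n = 2m.  As cⱼ = c₋ⱼ, the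
-- terms l and −l of the correlations ∑ₗ c_{l−i} c_{l+i} and ∑ₗ c_l c_{l+m} coincide, so only half
-- of each sum has to be known.  Modulo 8 the diagonal entry of C Cᵀ and its entry (i, −i), 0 < i < m,
-- then differ only through uᵢ + u_{m+i} − uₘ, which gives cᵢ c_{m+i} ≡ d + m + 2uₘ (mod 4).  Being
-- ±1, these products are one sign σ independent of i, and the entry (0, m) becomes
-- 2d cₘ + 2(m − 1)σ = 0, forcing d = m − 1.  Neither 5 = 59 nor 29 = 461.
module Submission where

open import Data.Empty using (⊥-elim)
open import Data.Fin using (Fin; toℕ; fromℕ<) renaming (zero to fzero; suc to fsuc)
open import Data.Fin.Properties using (toℕ-fromℕ<; fromℕ<-cong; fromℕ<-injective; _≟_)
open import Data.Integer using (ℤ; +_; -[1+_]; _+_; _*_; -_; _-_; ∣_∣)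
open import Data.Integer.Divisibility.Signed as ℤ∣ using (divides; ∣m∣n⇒∣m-n)
open import Data.Integer.Properties
  using ( +-comm; +-assoc; +-identityˡ; *-zeroˡ; *-zeroʳ; *-identityˡ; *-comm
        ; *-distribˡ-+; *-distribʳ-+; *-cancelˡ-≡; pos-*; abs-*; ∣-i∣≡∣i∣
        ; +-commutativeSemigroup; +-0-abelianGroup)
open import Algebra.Properties.AbelianGroup +-0-abelianGroup using () renaming (∙-cancelˡ to +-cancelˡ)
open import Algebra.Properties.CommutativeSemigroup +-commutativeSemigroup
  using () renaming (interchange to +-interchange)
open import Data.Integer.Tactic.RingSolver using (solve-∀)
open import Data.Nat as ℕ using (ℕ; zero; suc; _∸_; _<_; _≤_; z≤n; s≤s)
open import Data.Nat.Divisibility using (_∣_; divides; ∣m∣n⇒∣m+n; n∣n)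
open import Data.Nat.DivMod using (_%_; _/_; m%n<n; m%n%n≡m%n; [m+n]%n≡m%n; m<n⇒m%n≡m; m≡m%n+[m/n]*n; %-remove-+ʳ)
import Data.Nat.Properties as ℕ
import Data.Nat.Tactic.RingSolver as ℕ-Solver
open import Data.Product using (Σ; _×_; _,_; proj₁; proj₂)
open import Data.Sum using (_⊎_; inj₁; inj₂)
open import Function using (_∘_; case_of_)
open import Level using (Level)
open import Relation.Binary.PropositionalEquality
open import Relation.Nullary using (¬_; yes; no; contradiction)
open import Relation.Nullary.Decidable using (from-no)

open import Defs

open ≡-Reasoning

private
  variable
    ℓ : Level
    A : Set ℓ

∑< : ℕ → (ℕ → ℤ) → ℤ
∑< zero    f = + 0
∑< (suc n) f = f 0 + ∑< n (f ∘ suc)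

∑<-cong : ∀ n {f g : ℕ → ℤ} → (∀ l → l < n → f l ≡ g l) → ∑< n f ≡ ∑< n g
∑<-cong zero    eq = refl
∑<-cong (suc n) eq = cong₂ _+_ (eq 0 (s≤s z≤n)) (∑<-cong n (λ l l<n → eq (suc l) (s≤s l<n)))

∑<-distrib-+ : ∀ n (f g : ℕ → ℤ) → ∑< n (λ l → f l + g l) ≡ ∑< n f + ∑< n g
∑<-distrib-+ zero    f g = refl
∑<-distrib-+ (suc n) f g = begin
  (f 0 + g 0) + ∑< n (λ l → f (suc l) + g (suc l))
    ≡⟨ cong (_+_ (f 0 + g 0)) (∑<-distrib-+ n (f ∘ suc) (g ∘ suc)) ⟩
  (f 0 + g 0) + (∑< n (f ∘ suc) + ∑< n (g ∘ suc))
    ≡⟨ +-interchange (f 0) (g 0) _ _ ⟩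
  (f 0 + ∑< n (f ∘ suc)) + (g 0 + ∑< n (g ∘ suc)) ∎

∑<-*ˡ : ∀ n x (f : ℕ → ℤ) → ∑< n (λ l → x * f l) ≡ x * ∑< n f
∑<-*ˡ zero    x f = sym (*-zeroʳ x)
∑<-*ˡ (suc n) x f = begin
  x * f 0 + ∑< n (λ l → x * f (suc l)) ≡⟨ cong (_+_ (x * f 0)) (∑<-*ˡ n x (f ∘ suc)) ⟩
  x * f 0 + x * ∑< n (f ∘ suc)         ≡⟨ *-distribˡ-+ x (f 0) _ ⟨
  x * (f 0 + ∑< n (f ∘ suc))           ∎

∑<-const : ∀ n x → ∑< n (λ _ → x) ≡ + n * x
∑<-const zero    x = sym (*-zeroˡ x)
∑<-const (suc n) x = begin
  x + ∑< n (λ _ → x) ≡⟨ cong₂ _+_ (sym (*-identityˡ x)) (∑<-const n x) ⟩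
  + 1 * x + + n * x  ≡⟨ *-distribʳ-+ x (+ 1) (+ n) ⟨
  (+ 1 + + n) * x    ∎

∑<-init-last : ∀ n (f : ℕ → ℤ) → ∑< (suc n) f ≡ ∑< n f + f n
∑<-init-last zero    f = +-comm (f 0) (+ 0)
∑<-init-last (suc n) f = trans (cong (_+_ (f 0)) (∑<-init-last n (f ∘ suc))) (sym (+-assoc (f 0) _ _))

∑<-split : ∀ m n (f : ℕ → ℤ) → ∑< (m ℕ.+ n) f ≡ ∑< m f + ∑< n (λ l → f (m ℕ.+ l))
∑<-split zero    n f = sym (+-identityˡ _)
∑<-split (suc m) n f = trans (cong (_+_ (f 0)) (∑<-split m n (f ∘ suc))) (sym (+-assoc (f 0) _ _))

∑<-reverse : ∀ n (f : ℕ → ℤ) → ∑< n f ≡ ∑< n (λ l → f (n ∸ suc l))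
∑<-reverse zero    f = refl
∑<-reverse (suc n) f = begin
  ∑< (suc n) f                     ≡⟨ ∑<-init-last n f ⟩
  ∑< n f + f n                     ≡⟨ cong (_+ f n) (∑<-reverse n f) ⟩
  ∑< n (λ l → f (n ∸ suc l)) + f n ≡⟨ +-comm _ (f n) ⟩
  f n + ∑< n (λ l → f (n ∸ suc l)) ∎

∑<-rotate : ∀ n (f : ℕ → ℤ) → f n ≡ f 0 → ∑< n (f ∘ suc) ≡ ∑< n f
∑<-rotate n f fn≡f0 = +-cancelˡ (f 0) _ _ (begin
  f 0 + ∑< n (f ∘ suc) ≡⟨ ∑<-init-last n f ⟩
  ∑< n f + f n         ≡⟨ cong (_+_ (∑< n f)) fn≡f0 ⟩
  ∑< n f + f 0         ≡⟨ +-comm (∑< n f) (f 0) ⟩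
  f 0 + ∑< n f         ∎)

Periodic : ℕ → (ℕ → A) → Set _
Periodic n f = ∀ x → f (x ℕ.+ n) ≡ f x

∑<-shift : ∀ n {f : ℕ → ℤ} → Periodic n f → ∀ t → ∑< n (λ l → f (l ℕ.+ t)) ≡ ∑< n f
∑<-shift n {f} f-per zero    = ∑<-cong n (λ l _ → cong f (ℕ.+-identityʳ l))
∑<-shift n {f} f-per (suc t) = begin
  ∑< n (λ l → f (l ℕ.+ suc t)) ≡⟨ ∑<-cong n (λ l _ → cong f (ℕ.+-suc l t)) ⟩
  ∑< n (λ l → f (suc l ℕ.+ t)) ≡⟨ ∑<-rotate n (λ l → f (l ℕ.+ t)) (trans (cong f (ℕ.+-comm n t)) (f-per t)) ⟩
  ∑< n (λ l → f (l ℕ.+ t))     ≡⟨ ∑<-shift n f-per t ⟩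
  ∑< n f                       ∎

correlation : ℕ → (ℕ → ℤ) → ℕ → ℕ → ℤ
correlation n f a b = ∑< n (λ l → f (l ℕ.+ a) * f (l ℕ.+ b))

correlation-odd : ∀ n {c u : ℕ → ℤ} → Periodic n u → (∀ x → c x ≡ + 1 + + 2 * u x) → ∀ a b →
                  correlation n c a b ≡ + n + + 4 * ∑< n u + + 4 * correlation n u a b
correlation-odd n {c} {u} u-per c≡1+2u a b = begin
  ∑< n (λ l → c (l ℕ.+ a) * c (l ℕ.+ b))
    ≡⟨ ∑<-cong n (λ l _ → trans (cong₂ _*_ (c≡1+2u _) (c≡1+2u _)) (expand (X l) (Y l))) ⟩
  ∑< n (λ l → (+ 1 + + 2 * X l) + (+ 2 * Y l + + 4 * (X l * Y l)))
    ≡⟨ ∑<-distrib-+ n (λ l → + 1 + + 2 * X l) (λ l → + 2 * Y l + + 4 * (X l * Y l)) ⟩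
  ∑< n (λ l → + 1 + + 2 * X l) + ∑< n (λ l → + 2 * Y l + + 4 * (X l * Y l))
    ≡⟨ cong₂ _+_ (∑<-distrib-+ n (λ _ → + 1) (λ l → + 2 * X l))
                 (∑<-distrib-+ n (λ l → + 2 * Y l) (λ l → + 4 * (X l * Y l))) ⟩
  (∑< n (λ _ → + 1) + ∑< n (λ l → + 2 * X l)) + (∑< n (λ l → + 2 * Y l) + ∑< n (λ l → + 4 * (X l * Y l)))
    ≡⟨ cong₂ _+_ (cong₂ _+_ (∑<-const n (+ 1)) (∑<-*ˡ n (+ 2) X))
                 (cong₂ _+_ (∑<-*ˡ n (+ 2) Y) (∑<-*ˡ n (+ 4) (λ l → X l * Y l))) ⟩
  (+ n * + 1 + + 2 * ∑< n X) + (+ 2 * ∑< n Y + + 4 * correlation n u a b)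
    ≡⟨ cong₂ (λ x y → (+ n * + 1 + + 2 * x) + (+ 2 * y + + 4 * correlation n u a b))
             (∑<-shift n u-per a) (∑<-shift n u-per b) ⟩
  (+ n * + 1 + + 2 * ∑< n u) + (+ 2 * ∑< n u + + 4 * correlation n u a b)
    ≡⟨ collect (+ n) (∑< n u) (correlation n u a b) ⟩
  + n + + 4 * ∑< n u + + 4 * correlation n u a b ∎
  where
  X Y : ℕ → ℤ
  X l = u (l ℕ.+ a)
  Y l = u (l ℕ.+ b)
  expand : ∀ x y → (+ 1 + + 2 * x) * (+ 1 + + 2 * y) ≡ (+ 1 + + 2 * x) + (+ 2 * y + + 4 * (x * y))
  expand = solve-∀
  collect : ∀ n U R → (n * + 1 + + 2 * U) + (+ 2 * U + + 4 * R) ≡ n + + 4 * U + + 4 * R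
  collect = solve-∀

EvenModulo : ℕ → (ℕ → A) → Set _
EvenModulo n f = ∀ x y → n ∣ x ℕ.+ y → f x ≡ f y

evenModulo-reflect : ∀ {n} {f : ℕ → A} → EvenModulo n f → ∀ a b {s} → s ≤ n → n ∣ a ℕ.+ b →
                     f (n ∸ s ℕ.+ a) ≡ f (s ℕ.+ b)
evenModulo-reflect {n = n} f-even a b {s} s≤n n∣a+b =
  f-even (n ∸ s ℕ.+ a) (s ℕ.+ b) (subst (n ∣_) (sym sum≡n+a+b) (∣m∣n⇒∣m+n n∣n n∣a+b))
  where
  regroup : ∀ x s a b → (x ℕ.+ a) ℕ.+ (s ℕ.+ b) ≡ (x ℕ.+ s) ℕ.+ (a ℕ.+ b)
  regroup = ℕ-Solver.solve-∀
  sum≡n+a+b : (n ∸ s ℕ.+ a) ℕ.+ (s ℕ.+ b) ≡ n ℕ.+ (a ℕ.+ b)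
  sum≡n+a+b = trans (regroup (n ∸ s) s a b) (cong (ℕ._+ (a ℕ.+ b)) (ℕ.m∸n+n≡m s≤n))

module HalfPeriod (m' : ℕ) where

  m N : ℕ
  m = suc m'
  N = m ℕ.+ m

  ∑<-fold : ∀ (h : ℕ → ℤ) → (∀ s → s ≤ N → h (N ∸ s) ≡ h s) →
            ∑< N h ≡ h 0 + h m + + 2 * ∑< m' (h ∘ suc)
  ∑<-fold h h-even = begin
    ∑< N h
      ≡⟨ ∑<-split m m h ⟩
    (h 0 + S) + (h (m ℕ.+ 0) + ∑< m' (λ l → h (m ℕ.+ suc l)))
      ≡⟨ cong₂ (λ x y → (h 0 + S) + (h x + y)) (ℕ.+-identityʳ m) second-half-mirrors-first ⟩
    (h 0 + S) + (h m + S)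
      ≡⟨ regroup (h 0) (h m) S ⟩
    h 0 + h m + + 2 * S ∎
    where
    S : ℤ
    S = ∑< m' (h ∘ suc)
    regroup : ∀ x y z → (x + z) + (y + z) ≡ x + y + + 2 * z
    regroup = solve-∀
    mirror-index : ∀ {l} → l < m' → m ℕ.+ suc (m' ∸ suc l) ≡ N ∸ suc l
    mirror-index l<m' = sym (trans (ℕ.+-∸-assoc m (ℕ.m≤n⇒m≤1+n l<m')) (cong (m ℕ.+_) (ℕ.+-∸-assoc 1 l<m')))
    second-half-mirrors-first : ∑< m' (λ l → h (m ℕ.+ suc l)) ≡ S
    second-half-mirrors-first = trans (∑<-reverse m' _) (∑<-cong m' (λ l l<m' →
      trans (cong h (mirror-index l<m'))
            (h-even (suc l) (ℕ.≤-trans (ℕ.m≤n⇒m≤1+n l<m') (ℕ.m≤m+n m m)))))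

  correlation-fold : ∀ (f : ℕ → ℤ) → EvenModulo N f → ∀ a b →
                     (N ∣ a ℕ.+ b) ⊎ ((N ∣ a ℕ.+ a) × (N ∣ b ℕ.+ b)) →
                     correlation N f a b ≡ f a * f b + f (m ℕ.+ a) * f (m ℕ.+ b)
                                           + + 2 * ∑< m' (λ l → f (suc l ℕ.+ a) * f (suc l ℕ.+ b))
  correlation-fold f f-even a b shifts = ∑<-fold _ term-even
    where
    term-even : ∀ s → s ≤ N → f (N ∸ s ℕ.+ a) * f (N ∸ s ℕ.+ b) ≡ f (s ℕ.+ a) * f (s ℕ.+ b)
    term-even s s≤N = case shifts of λ where
      (inj₁ N∣a+b) → trans (cong₂ _*_ (evenModulo-reflect f-even a b s≤N N∣a+b)
                                      (evenModulo-reflect f-even b a s≤N (subst (N ∣_) (ℕ.+-comm a b) N∣a+b)))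
                           (*-comm (f (s ℕ.+ b)) (f (s ℕ.+ a)))
      (inj₂ (N∣a+a , N∣b+b)) → cong₂ _*_ (evenModulo-reflect f-even a a s≤N N∣a+a)
                                         (evenModulo-reflect f-even b b s≤N N∣b+b)

IsSign : ℤ → Set
IsSign x = x ≡ + 1 ⊎ x ≡ -[1+ 0 ]

sign-* : ∀ {x y} → IsSign x → IsSign y → IsSign (x * y)
sign-* (inj₁ refl) (inj₁ refl) = inj₁ refl
sign-* (inj₁ refl) (inj₂ refl) = inj₂ refl
sign-* (inj₂ refl) (inj₁ refl) = inj₂ refl
sign-* (inj₂ refl) (inj₂ refl) = inj₁ refl

∣sign∣≡1 : ∀ {x} → IsSign x → ∣ x ∣ ≡ 1
∣sign∣≡1 (inj₁ refl) = refl
∣sign∣≡1 (inj₂ refl) = refl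

signs-≡-mod-4 : ∀ {x y} → IsSign x → IsSign y → + 4 ℤ∣.∣ x - y → x ≡ y
signs-≡-mod-4 (inj₁ refl) (inj₁ refl) _   = refl
signs-≡-mod-4 (inj₁ refl) (inj₂ refl) 4∣2 = ⊥-elim (from-no (+ 4 ℤ∣.∣? + 2) 4∣2)
signs-≡-mod-4 (inj₂ refl) (inj₁ refl) 4∣-2 = ⊥-elim (from-no (+ 4 ℤ∣.∣? -[1+ 1 ]) 4∣-2)
signs-≡-mod-4 (inj₂ refl) (inj₂ refl) _   = refl

sign-balance : ∀ {s σ} m n → IsSign s → IsSign σ → + m * s + + n * σ ≡ + 0 → m ≡ n
sign-balance {s} {σ} m n s-sign σ-sign ms+nσ≡0 = begin
  m                  ≡⟨ ∣m*sign∣ m s-sign ⟨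
  ∣ + m * s ∣        ≡⟨ cong ∣_∣ ms≡-nσ ⟩
  ∣ - (+ n * σ) ∣    ≡⟨ ∣-i∣≡∣i∣ (+ n * σ) ⟩
  ∣ + n * σ ∣        ≡⟨ ∣m*sign∣ n σ-sign ⟩
  n                  ∎
  where
  ∣m*sign∣ : ∀ k {t} → IsSign t → ∣ + k * t ∣ ≡ k
  ∣m*sign∣ k {t} t-sign = trans (abs-* (+ k) t) (trans (cong (k ℕ.*_) (∣sign∣≡1 t-sign)) (ℕ.*-identityʳ k))
  ms≡-nσ : + m * s ≡ - (+ n * σ)
  ms≡-nσ = begin
    + m * s                        ≡⟨ x≡x+y-y (+ m * s) (+ n * σ) ⟩
    (+ m * s + + n * σ) - + n * σ  ≡⟨ cong (_- + n * σ) ms+nσ≡0 ⟩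
    + 0 - + n * σ                  ≡⟨ +-identityˡ (- (+ n * σ)) ⟩
    - (+ n * σ)                    ∎
    where
    x≡x+y-y : ∀ x y → x ≡ (x + y) - y
    x≡x+y-y = solve-∀

∑<-congruent-signs : ∀ n {g : ℕ → ℤ} e → (∀ i → i < n → IsSign (g i)) → (∀ i → i < n → + 4 ℤ∣.∣ g i - e) →
                     Σ ℤ λ σ → IsSign σ × ∑< n g ≡ + n * σ
∑<-congruent-signs zero    e _ _ = + 1 , inj₁ refl , refl
∑<-congruent-signs (suc n) {g} e signs g≡e =
  g 0 , signs 0 (s≤s z≤n) , trans (∑<-cong (suc n) all≡g0) (∑<-const (suc n) (g 0))
  where
  difference : ∀ x y e → (x - e) - (y - e) ≡ x - y
  difference = solve-∀
  all≡g0 : ∀ i → i < suc n → g i ≡ g 0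
  all≡g0 i i<n = signs-≡-mod-4 (signs i i<n) (signs 0 (s≤s z≤n))
    (subst (+ 4 ℤ∣.∣_) (difference (g i) (g 0) e) (∣m∣n⇒∣m-n (g≡e i i<n) (g≡e 0 (s≤s z≤n))))

cyclic : ∀ {n} → (Fin (suc n) → A) → ℕ → A
cyclic {n = n} v x = v (fromℕ< (m%n<n x (suc n)))

module _ {n} (v : Fin (suc n) → A) where

  cyclic-cong : ∀ x y → x % suc n ≡ y % suc n → cyclic v x ≡ cyclic v y
  cyclic-cong x y eq = cong v (fromℕ<-cong _ _ eq (m%n<n x (suc n)) (m%n<n y (suc n)))

  cyclic-periodic : Periodic (suc n) (cyclic v)
  cyclic-periodic x = cyclic-cong (x ℕ.+ suc n) x ([m+n]%n≡m%n x (suc n))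

  cyclic-fromℕ< : ∀ {x} (x<n : x < suc n) → cyclic v x ≡ v (fromℕ< x<n)
  cyclic-fromℕ< {x} x<n = cong v (fromℕ<-cong _ _ (m<n⇒m%n≡m x<n) (m%n<n x (suc n)) x<n)

symmetric⇒evenModulo : ∀ {n} (c : Fin (suc n) → ℤ) → Symmetric (circulant c) → EvenModulo (suc n) (cyclic c)
symmetric⇒evenModulo {n} c C-sym x y N∣x+y = begin
  cyclic c x                         ≡⟨ cyclic-cong c r x (m%n%n≡m%n x N) ⟨
  cyclic c r                         ≡⟨ cyclic-periodic c r ⟨
  cyclic c (r ℕ.+ N)                 ≡⟨ cong (λ z → cyclic c (z ℕ.+ N)) (toℕ-fromℕ< r<N) ⟨
  circulant c fzero (fromℕ< r<N)     ≡⟨ C-sym fzero (fromℕ< r<N) ⟩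
  circulant c (fromℕ< r<N) fzero     ≡⟨ cong (λ z → cyclic c (N ∸ z)) (toℕ-fromℕ< r<N) ⟩
  cyclic c (N ∸ r)                   ≡⟨ cyclic-cong c (N ∸ r) y N∸r≡y ⟩
  cyclic c y                         ∎
  where
  N r : ℕ
  N = suc n
  r = x % N
  r<N : r < N
  r<N = m%n<n x N
  N∣N∸r+x : N ∣ (N ∸ r) ℕ.+ x
  N∣N∸r+x = divides (suc (x / N)) (begin
    (N ∸ r) ℕ.+ x                   ≡⟨ cong ((N ∸ r) ℕ.+_) (m≡m%n+[m/n]*n x N) ⟩
    (N ∸ r) ℕ.+ (r ℕ.+ x / N ℕ.* N) ≡⟨ ℕ.+-assoc (N ∸ r) r _ ⟨
    (N ∸ r) ℕ.+ r ℕ.+ x / N ℕ.* N   ≡⟨ cong (ℕ._+ x / N ℕ.* N) (ℕ.m∸n+n≡m (ℕ.<⇒≤ r<N)) ⟩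
    N ℕ.+ x / N ℕ.* N               ∎)
  regroup : ∀ z x y → z ℕ.+ (x ℕ.+ y) ≡ y ℕ.+ (z ℕ.+ x)
  regroup = ℕ-Solver.solve-∀
  N∸r≡y : (N ∸ r) % N ≡ y % N
  N∸r≡y = begin
    (N ∸ r) % N                       ≡⟨ %-remove-+ʳ (N ∸ r) N∣x+y ⟨
    ((N ∸ r) ℕ.+ (x ℕ.+ y)) % N       ≡⟨ cong (_% N) (regroup (N ∸ r) x y) ⟩
    (y ℕ.+ ((N ∸ r) ℕ.+ x)) % N       ≡⟨ %-remove-+ʳ y N∣N∸r+x ⟩
    y % N                             ∎

sumFin≡∑< : ∀ {n} (g : Fin n → ℤ) (G : ℕ → ℤ) → (∀ j → g j ≡ G (toℕ j)) → sumFin g ≡ ∑< n G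
sumFin≡∑< {zero}  g G eq = refl
sumFin≡∑< {suc n} g G eq = cong₂ _+_ (eq fzero) (sumFin≡∑< (g ∘ fsuc) (G ∘ suc) (eq ∘ fsuc))

gram-entry : ∀ {n} (c : Fin (suc n) → ℤ) {a b} (a<n : a < suc n) (b<n : b < suc n) →
             (circulant c · transpose (circulant c)) (fromℕ< a<n) (fromℕ< b<n)
               ≡ correlation (suc n) (cyclic c) (suc n ∸ a) (suc n ∸ b)
gram-entry {n} c {a} {b} a<n b<n =
  sumFin≡∑< {suc n} _ (λ l → cyclic c (l ℕ.+ (suc n ∸ a)) * cyclic c (l ℕ.+ (suc n ∸ b))) (λ j →
    cong₂ _*_ (cong (λ z → cyclic c (toℕ j ℕ.+ (suc n ∸ z))) (toℕ-fromℕ< a<n))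
              (cong (λ z → cyclic c (toℕ j ℕ.+ (suc n ∸ z))) (toℕ-fromℕ< b<n)))

scalar-diagonal : ∀ {n} x (i : Fin n) → scalar x i i ≡ x
scalar-diagonal x i with i ≟ i
... | yes _   = refl
... | no i≢i  = ⊥-elim (i≢i refl)

scalar-off-diagonal : ∀ {n} x {i j : Fin n} → i ≢ j → scalar x i j ≡ + 0
scalar-off-diagonal x {i} {j} i≢j with i ≟ j
... | yes i≡j = ⊥-elim (i≢j i≡j)
... | no _    = refl

bit : ∀ {x} → IsSign x → ℤ
bit (inj₁ _) = + 0
bit (inj₂ _) = -[1+ 0 ]

sign≡1+2bit : ∀ {x} (s : IsSign x) → x ≡ + 1 + + 2 * bit s
sign≡1+2bit (inj₁ refl) = refl
sign≡1+2bit (inj₂ refl) = refl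

bit-square : ∀ {x} (s : IsSign x) → bit s * bit s ≡ - bit s
bit-square (inj₁ _) = refl
bit-square (inj₂ _) = refl

1+2*-injective : ∀ {x y} → + 1 + + 2 * x ≡ + 1 + + 2 * y → x ≡ y
1+2*-injective {x} {y} eq = *-cancelˡ-≡ (+ 2) x y (+-cancelˡ (+ 1) _ _ eq)

-- The hypotheses are the diagonal entry and the entry (i, −i) of C Cᵀ for the generator 1 + 2u,
-- with the correlations of u folded and uⱼ² = −uⱼ applied: n = 2m, U = ∑ uⱼ, h = u₀, x = uᵢ,
-- y = u_{m+i}, z = uₘ, and m' = m − 1.
product-mod-4 : ∀ n U h m' z x y Z₀ Zᵢ →
                n + + 4 * U + + 4 * (h * h - z + + 2 * Z₀) ≡ (+ 1 + + 2 * h) * (+ 1 + + 2 * h) + (m' + (+ 1 + m')) →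
                n + + 4 * U + + 4 * (- x - y + + 2 * Zᵢ) ≡ + 0 →
                + 4 ℤ∣.∣ (+ 1 + + 2 * x) * (+ 1 + + 2 * y) - (+ 2 + + 2 * h + m' + + 2 * z)
product-mod-4 n U h m' z x y Z₀ Zᵢ diagonal antidiagonal = divides W (*-cancelˡ-≡ (+ 2) _ _ (begin
  + 2 * (τ - E)                            ≡⟨ identity ⟩
  + 2 * (W * + 4) + ((Dₗ - Dᵣ) - Aₗ)       ≡⟨ cong₂ (λ p q → + 2 * (W * + 4) + ((p - Dᵣ) - q)) diagonal antidiagonal ⟩
  + 2 * (W * + 4) + ((Dᵣ - Dᵣ) - + 0)     ≡⟨ cancel (+ 2 * (W * + 4)) Dᵣ ⟩
  + 2 * (W * + 4)                          ∎))
  where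
  τ E W Dₗ Dᵣ Aₗ : ℤ
  τ  = (+ 1 + + 2 * x) * (+ 1 + + 2 * y)
  E  = + 2 + + 2 * h + m' + + 2 * z
  W  = x * y - Z₀ + Zᵢ
  Dₗ = n + + 4 * U + + 4 * (h * h - z + + 2 * Z₀)
  Dᵣ = (+ 1 + + 2 * h) * (+ 1 + + 2 * h) + (m' + (+ 1 + m'))
  Aₗ = n + + 4 * U + + 4 * (- x - y + + 2 * Zᵢ)
  identity : + 2 * (τ - E) ≡ + 2 * (W * + 4) + ((Dₗ - Dᵣ) - Aₗ)
  identity = polynomial-identity n U h m' z x y Z₀ Zᵢ
    where
    polynomial-identity : ∀ n U h m' z x y Z₀ Zᵢ →
      + 2 * ((+ 1 + + 2 * x) * (+ 1 + + 2 * y) - (+ 2 + + 2 * h + m' + + 2 * z))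
        ≡ + 2 * ((x * y - Z₀ + Zᵢ) * + 4)
          + (((n + + 4 * U + + 4 * (h * h - z + + 2 * Z₀))
              - ((+ 1 + + 2 * h) * (+ 1 + + 2 * h) + (m' + (+ 1 + m'))))
             - (n + + 4 * U + + 4 * (- x - y + + 2 * Zᵢ)))
    polynomial-identity = solve-∀
  cancel : ∀ a b → a + ((b - b) - + 0) ≡ a
  cancel = solve-∀

module EvenOrder (m' h : ℕ) (c : Fin (suc m' ℕ.+ suc m') → ℤ)
                 (good : GoodCirculant (m' ℕ.+ suc m') (1 ℕ.+ 2 ℕ.* h) c) where

  open HalfPeriod m'

  d : ℕ
  d = 1 ℕ.+ 2 ℕ.* h

  k : ℤ
  k = + (d ℕ.* d ℕ.+ (m' ℕ.+ m))

  c₀≡d : c fzero ≡ + d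
  c₀≡d = proj₁ good

  c-sign : ∀ j → IsSign (c (fsuc j))
  c-sign = proj₁ (proj₂ good)

  CCᵀ≡kI : ∀ i j → (circulant c · transpose (circulant c)) i j ≡ scalar k i j
  CCᵀ≡kI = proj₂ (proj₂ (proj₂ good))

  +d≡1+2h : + d ≡ + 1 + + 2 * + h
  +d≡1+2h = cong (_+_ (+ 1)) (pos-* 2 h)

  k≡d²+n-1 : k ≡ (+ 1 + + 2 * + h) * (+ 1 + + 2 * + h) + (+ m' + (+ 1 + + m'))
  k≡d²+n-1 = cong (_+ + (m' ℕ.+ m)) (trans (pos-* d d) (cong₂ _*_ +d≡1+2h +d≡1+2h))

  u : Fin N → ℤ
  u fzero    = + h
  u (fsuc j) = bit (c-sign j)

  c≡1+2u : ∀ j → c j ≡ + 1 + + 2 * u j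
  c≡1+2u fzero    = trans c₀≡d +d≡1+2h
  c≡1+2u (fsuc j) = sign≡1+2bit (c-sign j)

  c̃ ũ : ℕ → ℤ
  c̃ = cyclic c
  ũ = cyclic u

  c̃≡1+2ũ : ∀ x → c̃ x ≡ + 1 + + 2 * ũ x
  c̃≡1+2ũ x = c≡1+2u _

  c̃-even : EvenModulo N c̃
  c̃-even = symmetric⇒evenModulo c (proj₁ (proj₂ (proj₂ good)))

  ũ-even : EvenModulo N ũ
  ũ-even x y N∣x+y = 1+2*-injective (trans (sym (c̃≡1+2ũ x)) (trans (c̃-even x y N∣x+y) (c̃≡1+2ũ y)))

  c̃-sign : ∀ {x} → 0 < x → x < N → IsSign (c̃ x)
  c̃-sign {suc x} _ x<N = subst IsSign (sym (cyclic-fromℕ< c x<N)) (c-sign _)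

  ũ-square : ∀ {x} → 0 < x → x < N → ũ x * ũ x ≡ - ũ x
  ũ-square {suc x} _ x<N = subst (λ z → z * z ≡ - z) (sym (cyclic-fromℕ< u x<N)) (bit-square (c-sign _))

  orthogonal : ∀ {a b} (a<N : a < N) (b<N : b < N) → a ≢ b → correlation N c̃ (N ∸ a) (N ∸ b) ≡ + 0
  orthogonal {a} {b} a<N b<N a≢b = begin
    correlation N c̃ (N ∸ a) (N ∸ b)                               ≡⟨ gram-entry c a<N b<N ⟨
    (circulant c · transpose (circulant c)) (fromℕ< a<N) (fromℕ< b<N) ≡⟨ CCᵀ≡kI _ _ ⟩
    scalar k (fromℕ< a<N) (fromℕ< b<N)                              ≡⟨ scalar-off-diagonal k (a≢b ∘ fromℕ<-injective _ _ a<N b<N) ⟩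
    + 0                                                             ∎

  0<N : 0 < N
  0<N = s≤s z≤n

  m<N : m < N
  m<N = ℕ.m<m+n m (s≤s z≤n)

  N∣N+N : N ∣ N ℕ.+ N
  N∣N+N = divides 2 (cong (N ℕ.+_) (sym (ℕ.+-identityʳ N)))

  U : ℤ
  U = ∑< N ũ

  diagonal : Σ ℤ λ Z → + N + + 4 * U + + 4 * (+ h * + h - ũ m + + 2 * Z) ≡ k
  diagonal = _ , (begin
    + N + + 4 * U + + 4 * (+ h * + h - ũ m + + 2 * Z)
      ≡⟨ cong₂ (λ v w → + N + + 4 * U + + 4 * (v + w + + 2 * Z))
               (sym (cong₂ _*_ ũN≡h ũN≡h))
               (sym (trans (cong₂ _*_ ũm+N≡ũm ũm+N≡ũm) (ũ-square (s≤s z≤n) m<N))) ⟩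
    + N + + 4 * U + + 4 * (ũ N * ũ N + ũ (m ℕ.+ N) * ũ (m ℕ.+ N) + + 2 * Z)
      ≡⟨ cong (λ w → + N + + 4 * U + + 4 * w) (correlation-fold ũ ũ-even N N (inj₁ N∣N+N)) ⟨
    + N + + 4 * U + + 4 * correlation N ũ N N
      ≡⟨ correlation-odd N (cyclic-periodic u) c̃≡1+2ũ N N ⟨
    correlation N c̃ N N
      ≡⟨ gram-entry c 0<N 0<N ⟨
    (circulant c · transpose (circulant c)) fzero fzero
      ≡⟨ trans (CCᵀ≡kI fzero fzero) (scalar-diagonal {N} k fzero) ⟩
    k ∎)
    where
    Z : ℤ
    Z = ∑< m' (λ l → ũ (suc l ℕ.+ N) * ũ (suc l ℕ.+ N))
    ũN≡h : ũ N ≡ + h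
    ũN≡h = cyclic-periodic u 0
    ũm+N≡ũm : ũ (m ℕ.+ N) ≡ ũ m
    ũm+N≡ũm = cyclic-periodic u m

  antidiagonal : ∀ {i} → 0 < i → i < m → Σ ℤ λ Z → + N + + 4 * U + + 4 * (- ũ i - ũ (m ℕ.+ i) + + 2 * Z) ≡ + 0
  antidiagonal {i} 0<i i<m = _ , (begin
    + N + + 4 * U + + 4 * (- ũ i - ũ (m ℕ.+ i) + + 2 * Z)
      ≡⟨ cong₂ (λ v w → + N + + 4 * U + + 4 * (v + w + + 2 * Z)) (sym square-i) (sym square-m+i) ⟩
    + N + + 4 * U + + 4 * (ũ (N ∸ i) * ũ i + ũ (m ℕ.+ (N ∸ i)) * ũ (m ℕ.+ i) + + 2 * Z)
      ≡⟨ cong (λ w → + N + + 4 * U + + 4 * w) (correlation-fold ũ ũ-even (N ∸ i) i (inj₁ N∣N∸i+i)) ⟨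
    + N + + 4 * U + + 4 * correlation N ũ (N ∸ i) i
      ≡⟨ correlation-odd N (cyclic-periodic u) c̃≡1+2ũ (N ∸ i) i ⟨
    correlation N c̃ (N ∸ i) i
      ≡⟨ cong (correlation N c̃ (N ∸ i)) (ℕ.m∸[m∸n]≡n i≤N) ⟨
    correlation N c̃ (N ∸ i) (N ∸ (N ∸ i))
      ≡⟨ orthogonal i<N N∸i<N i≢N∸i ⟩
    + 0 ∎)
    where
    Z : ℤ
    Z = ∑< m' (λ l → ũ (suc l ℕ.+ (N ∸ i)) * ũ (suc l ℕ.+ i))
    i<N : i < N
    i<N = ℕ.<-≤-trans i<m (ℕ.m≤m+n m m)
    i≤N : i ≤ N
    i≤N = ℕ.<⇒≤ i<N
    N∸i<N : N ∸ i < N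
    N∸i<N = ℕ.∸-monoʳ-< 0<i i≤N
    N∸i+i≡N : N ∸ i ℕ.+ i ≡ N
    N∸i+i≡N = ℕ.m∸n+n≡m i≤N
    i≢N∸i : i ≢ N ∸ i
    i≢N∸i i≡N∸i = ℕ.<-irrefl (trans (cong (ℕ._+ i) i≡N∸i) N∸i+i≡N) (ℕ.+-mono-< i<m i<m)
    N∣N∸i+i : N ∣ N ∸ i ℕ.+ i
    N∣N∸i+i = subst (N ∣_) (sym N∸i+i≡N) n∣n
    regroup : ∀ m x i → (m ℕ.+ x) ℕ.+ (m ℕ.+ i) ≡ (m ℕ.+ m) ℕ.+ (x ℕ.+ i)
    regroup = ℕ-Solver.solve-∀
    N∣m+N∸i+m+i : N ∣ (m ℕ.+ (N ∸ i)) ℕ.+ (m ℕ.+ i)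
    N∣m+N∸i+m+i = subst (N ∣_) (sym (trans (regroup m (N ∸ i) i) (cong (N ℕ.+_) N∸i+i≡N))) N∣N+N
    square-i : ũ (N ∸ i) * ũ i ≡ - ũ i
    square-i = trans (cong (_* ũ i) (ũ-even (N ∸ i) i N∣N∸i+i)) (ũ-square 0<i i<N)
    square-m+i : ũ (m ℕ.+ (N ∸ i)) * ũ (m ℕ.+ i) ≡ - ũ (m ℕ.+ i)
    square-m+i = trans (cong (_* ũ (m ℕ.+ i)) (ũ-even (m ℕ.+ (N ∸ i)) (m ℕ.+ i) N∣m+N∸i+m+i))
                       (ũ-square (ℕ.<-≤-trans 0<i (ℕ.m≤n+m i m)) (ℕ.+-monoʳ-< m i<m))

  E : ℤ
  E = + 2 + + 2 * + h + + m' + + 2 * ũ m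

  product-congruence : ∀ {i} → 0 < i → i < m → + 4 ℤ∣.∣ c̃ i * c̃ (m ℕ.+ i) - E
  product-congruence {i} 0<i i<m =
    subst (λ τ → + 4 ℤ∣.∣ τ - E) (sym (cong₂ _*_ (c̃≡1+2ũ i) (c̃≡1+2ũ (m ℕ.+ i))))
          (product-mod-4 (+ N) U (+ h) (+ m') (ũ m) (ũ i) (ũ (m ℕ.+ i)) _ _
                         (trans (proj₂ diagonal) k≡d²+n-1) (proj₂ (antidiagonal 0<i i<m)))

  S : ℤ
  S = ∑< m' (λ l → c̃ (suc l) * c̃ (m ℕ.+ suc l))

  S≡m'σ : Σ ℤ λ σ → IsSign σ × S ≡ + m' * σ
  S≡m'σ = ∑<-congruent-signs m' E
    (λ l l<m' → sign-* (c̃-sign (s≤s z≤n) (ℕ.<-≤-trans (s≤s l<m') (ℕ.m≤m+n m m)))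
                       (c̃-sign (s≤s z≤n) (ℕ.+-monoʳ-< m (s≤s l<m'))))
    (λ l l<m' → product-congruence (s≤s z≤n) (s≤s l<m'))

  half-shift-orthogonality : + d * c̃ m + S ≡ + 0
  half-shift-orthogonality = *-cancelˡ-≡ (+ 2) _ (+ 0) (begin
    + 2 * (+ d * c̃ m + S)
      ≡⟨ double (+ d) (c̃ m) S ⟩
    + d * c̃ m + c̃ m * + d + + 2 * S
      ≡⟨ cong₂ (λ x y → x + y + + 2 * S) (cong (_* c̃ m) (sym c̃N≡d)) (cong₂ _*_ (sym (cyclic-periodic c m)) (sym c̃N≡d)) ⟩
    c̃ N * c̃ m + c̃ (m ℕ.+ N) * c̃ (m ℕ.+ m) + + 2 * S
      ≡⟨ cong (λ x → c̃ N * c̃ m + c̃ (m ℕ.+ N) * c̃ (m ℕ.+ m) + + 2 * x) (∑<-cong m' (λ l _ →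
           cong₂ _*_ (sym (cyclic-periodic c (suc l))) (cong c̃ (ℕ.+-comm m (suc l))))) ⟩
    c̃ N * c̃ m + c̃ (m ℕ.+ N) * c̃ (m ℕ.+ m) + + 2 * ∑< m' (λ l → c̃ (suc l ℕ.+ N) * c̃ (suc l ℕ.+ m))
      ≡⟨ correlation-fold c̃ c̃-even N m (inj₂ (N∣N+N , n∣n)) ⟨
    correlation N c̃ N m
      ≡⟨ cong (correlation N c̃ N) (ℕ.m+n∸m≡n m m) ⟨
    correlation N c̃ (N ∸ 0) (N ∸ m)
      ≡⟨ orthogonal 0<N m<N (λ ()) ⟩
    + 0
      ≡⟨ *-zeroʳ (+ 2) ⟨
    + 2 * + 0 ∎)
    where
    c̃N≡d : c̃ N ≡ + d
    c̃N≡d = trans (cyclic-periodic c 0) c₀≡d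
    double : ∀ x y z → + 2 * (x * y + z) ≡ x * y + y * x + + 2 * z
    double = solve-∀

  d≡m' : d ≡ m'
  d≡m' = let σ , σ-sign , S≡m'σ = S≡m'σ in
    sign-balance d m' (c̃-sign (s≤s z≤n) m<N) σ-sign (trans (cong (_+_ (+ d * c̃ m)) (sym S≡m'σ)) half-shift-orthogonality)

goodCirculant⇒diagonal≡halfOrder∸1 : ∀ m h (c : Fin (suc m ℕ.+ suc m) → ℤ) →
                                     GoodCirculant (m ℕ.+ suc m) (1 ℕ.+ 2 ℕ.* h) c → 1 ℕ.+ 2 ℕ.* h ≡ m
goodCirculant⇒diagonal≡halfOrder∸1 m h c good = EvenOrder.d≡m' m h c good

proposition4p8 : (¬ Σ (Fin 120 → ℤ) (λ c → GoodCirculant 119 5 c))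
               × (¬ Σ (Fin 924 → ℤ) (λ c → GoodCirculant 923 29 c))
proposition4p8 = (λ (c , good) → contradiction (goodCirculant⇒diagonal≡halfOrder∸1 59 2 c good) λ ())
               , (λ (c , good) → contradiction (goodCirculant⇒diagonal≡halfOrder∸1 461 14 c good) λ ())
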